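{- Let $C\ge 2$ be even, $D\ge 1$, and let $\mathcal{S}=(S_i)_{i=1}^{2^{D-1}}$ be a partition of $C\cdot 2^{D-1}$ distinct labels into sets of size $C$. Then the simultaneous multicast instance $M_{\mathcal{S}}$ has congestion $C$ and dilation $D$.
   Context: Interleaving: for two sets $S_1,S_2$ of $C$ labels each, $I(S_1,S_2)=\{S_1'\cup S_2' : S_j'\subseteq S_j, |S_j'|=C/2\}$. For a tuple $\mathcal{S}=(S_i)_{i=1}^{2^{D-1}}$ of pairwise disjoint $C$-element label sets ($D\ge 2$), $I(\mathcal{S})=\prod_{i=1}^{2^{D-2}} I(S_{2i-1},S_{2i})$. Construction of the labeled graph $G_{\mathcal{S}}$ by recursion on $D$: If $D=1$, $G_{\mathcal{S}}$ is a single edge $(r,v)$ carrying all labels of $S_1$, with $r$ the root of every label. If $D>1$: (1) for each $i=1,\dots,2^{D-2}$ introduce new vertices $r_{2i-1},r_{2i},v_i$ and edges $e_{2i-1}=(r_{2i-1},v_i)$, $e_{2i}=(r_{2i},v_i)$; $e_j$ carries all labels of $S_j$ and $r_j$ is the root of every label of $S_j$; (2) add the disjoint union of $G_{\mathcal{S}'}$ for all $\mathcal{S}'\in I(\mathcal{S})$, edges keeping their labels; (3) in each copy, every root vertex $r$ is incident to a single edge with label set $\chi(r)$; if $\chi(r)\in I(S_{2i-1},S_{2i})$, identify $r$ with $v_i$. $M_{\mathcal{S}}$ is the simultaneous multicast instance on $G_{\mathcal{S}}$ with one tree per label (the edges carrying that label, rooted at the label's root). Congestion is the maximum over edges of the number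 of trees containing the edge; dilation is the maximum depth of a tree. -}

module Defs where

open import Data.Nat using (ℕ; zero; suc; _+_; _*_; _∸_; _^_; _≤_; _<_; ⌊_/2⌋; _⊔_)
import Data.Nat as ℕ
open import Data.List using (List; []; _∷_; _++_; map; concat; concatMap; length; filter; foldr)
open import Data.List.Membership.Propositional using (_∈_)
open import Data.List.Membership.DecPropositional ℕ._≟_ using (_∈?_)
open import Data.Product using (_×_; _,_; Σ; ∃; ∃-syntax; proj₁; proj₂)
open import Data.Sum using (_⊎_)
open import Relation.Binary.PropositionalEquality using (_≡_)
open import Relation.Nullary using (¬_; yes; no)

-- Labels are natural numbers; a label set is a list of (distinct) labels.

Label : Set
Label = ℕ

LabelSet : Set
LabelSet = List Label

choose : ℕ → List Label → List LabelSet
choose zero    xs       = [] ∷ []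
choose (suc k) []       = []
choose (suc k) (x ∷ xs) = map (x ∷_) (choose k xs) ++ choose (suc k) xs

-- I(S₁,S₂) = { S₁' ∪ S₂' : S_j' ⊆ S_j, |S_j'| = h }   (h = C/2)
interleave₂ : ℕ → LabelSet → LabelSet → List LabelSet
interleave₂ h S₁ S₂ = concatMap (λ a → map (λ b → a ++ b) (choose h S₂)) (choose h S₁)

sequenceL : List (List LabelSet) → List (List LabelSet)
sequenceL []          = [] ∷ []
sequenceL (xs ∷ xss)  = concatMap (λ x → map (x ∷_) (sequenceL xss)) xs

pairs : List LabelSet → List (LabelSet × LabelSet)
pairs (a ∷ b ∷ xs) = (a , b) ∷ pairs xs
pairs _            = []

-- I(𝒮) = ∏ᵢ I(S_{2i-1}, S_{2i})
interleave : ℕ → List LabelSet → List (List LabelSet)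
interleave h 𝒮 = sequenceL (map (λ p → interleave₂ h (proj₁ p) (proj₂ p)) (pairs 𝒮))

imapFrom : {A B : Set} → ℕ → (ℕ → A → B) → List A → List B
imapFrom n f []       = []
imapFrom n f (x ∷ xs) = f n x ∷ imapFrom (suc n) f xs

imap : {A B : Set} → (ℕ → A → B) → List A → List B
imap = imapFrom 0

-- Vertices of G_𝒮 (0-based indices):
--   rt j        : the root vertex r_{j+1}
--   vt i        : the vertex v_{i+1}
--   inner c w   : vertex w of the c-th recursive copy (not identified)

data Vtx : Set where
  rt    : ℕ → Vtx
  vt    : ℕ → Vtx
  inner : ℕ → Vtx → Vtx

record Edge : Set where
  constructor edge
  field
    end₁   : Vtx
    end₂   : Vtx
    labels : LabelSet
open Edge public

-- Step (3): in copy c, a root vertex r'_k of the copy (root of the labels of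
-- S'_k ∈ I(S_{2k-1},S_{2k})) is identified with v_k; every other vertex of
-- the copy stays a fresh vertex of that copy.
renameV : ℕ → Vtx → Vtx
renameV c (rt k) = vt k
renameV c w      = inner c w

renameE : ℕ → Edge → Edge
renameE c (edge a b L) = edge (renameV c a) (renameV c b) L

-- Edges of G_𝒮, where the tuple 𝒮 has 2^d entries, i.e. d = D - 1.
-- h = C/2.
edgesG : ℕ → ℕ → List LabelSet → List Edge
edgesG h zero    𝒮 = edge (rt 0) (vt 0) (concat 𝒮) ∷ []
edgesG h (suc d) 𝒮 =
  concat (imap (λ i p → edge (rt (2 * i)) (vt i) (proj₁ p)
                      ∷ edge (rt (suc (2 * i))) (vt i) (proj₂ p) ∷ [])
               (pairs 𝒮))
  ++ concat (imap (λ c 𝒮' → map (renameE c) (edgesG h d 𝒮')) (interleave h 𝒮))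

indexOf : Label → List LabelSet → ℕ
indexOf ℓ []       = 0
indexOf ℓ (S ∷ 𝒮) with ℓ ∈? S
... | yes _ = 0
... | no  _ = suc (indexOf ℓ 𝒮)

-- Root of label ℓ in G_𝒮: r_j for ℓ ∈ S_j  (for D = 1: the single root r).
rootG : ℕ → List LabelSet → Label → Vtx
rootG zero    𝒮 ℓ = rt 0
rootG (suc d) 𝒮 ℓ = rt (indexOf ℓ 𝒮)

-- A (simultaneous) multicast instance: a labeled graph (edge list), the
-- list of labels, and a root for each label. The tree of label ℓ consists of
-- the edges carrying ℓ, rooted at root ℓ.

record Multicast : Set where
  field
    edges     : List Edge
    allLabels : List Label
    root      : Label → Vtx
open Multicast public

M : ℕ → ℕ → List LabelSet → Multicast
M h d 𝒮 = record { edges = edgesG h d 𝒮 ; allLabels = concat 𝒮 ; root = rootG d 𝒮 }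

load : Multicast → Edge → ℕ
load I e = length (filter (λ ℓ → ℓ ∈? labels e) (allLabels I))

congestion : Multicast → ℕ
congestion I = foldr (λ e m → load I e ⊔ m) 0 (edges I)

TreeEdge : Multicast → Label → Edge → Set
TreeEdge I ℓ e = e ∈ edges I × ℓ ∈ labels e

TreeVtx : Multicast → Label → Vtx → Set
TreeVtx I ℓ x = x ≡ root I ℓ ⊎ ∃[ e ] (TreeEdge I ℓ e × (x ≡ end₁ e ⊎ x ≡ end₂ e))

data Walk (I : Multicast) (ℓ : Label) : Vtx → Vtx → ℕ → Set where
  stop  : ∀ {x} → Walk I ℓ x x 0
  fwd   : ∀ {y n} e → TreeEdge I ℓ e → Walk I ℓ (end₂ e) y n → Walk I ℓ (end₁ e) y (suc n)
  bwd   : ∀ {y n} e → TreeEdge I ℓ e → Walk I ℓ (end₁ e) y n → Walk I ℓ (end₂ e) y (suc n)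

DistFromRoot : Multicast → Label → Vtx → ℕ → Set
DistFromRoot I ℓ x n = Walk I ℓ (root I ℓ) x n × (∀ m → m < n → ¬ Walk I ℓ (root I ℓ) x m)

HasDilation : Multicast → ℕ → Set
HasDilation I D =
  (∀ ℓ → ℓ ∈ allLabels I → ∀ x → TreeVtx I ℓ x → ∃[ n ] (n ≤ D × Walk I ℓ (root I ℓ) x n))
  × (∃[ ℓ ] (ℓ ∈ allLabels I × ∃[ x ] (TreeVtx I ℓ x × DistFromRoot I ℓ x D)))

module Submission where

-- Write h = C/2 and d = D - 1, so that 𝒮 consists of 2^d parts of size 2h
-- (the predicate WellFormed h d 𝒮).  Give every vertex of G_𝒮 a level:
-- roots r_j have level 0, the vertices v_i level 1, and a vertex of a
-- recursive copy has one more than its level inside the copy.  Each of the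
-- following facts about G_𝒮 is proved by induction on d, using that every
-- edge of G_𝒮 is either one of the top edges e_j or a renamed edge of a copy
-- G_𝒮′ for an interleaving 𝒮′ ∈ I(𝒮), which is well formed one level lower:
--  * edge-levels: every edge runs from some level k to level k+1 ≤ D, so a
--    walk of length m from a root only reaches vertices of level ≤ m;
--  * edge-labels: every edge carries a 2h-element sublist of the labels;
--  * walk-from-root: every vertex x of the tree of ℓ is reached from the root
--    of ℓ by a walk of length level x, because the root of ℓ inside a copy is
--    entered from the root of ℓ in G_𝒮 through a top edge (copy-entry);
--  * deepest-edge: some edge ends at level D.
-- As the labels are distinct, every edge has load exactly C = 2h, giving the
-- congestion; the distance of a tree vertex from its root is its level, which
-- is at most D and equals D at the deepest edge, giving the dilation.

open import Defs
open import Data.Nat using (ℕ; zero; suc; _+_; _*_; _≤_; _∸_; _^_; ⌊_/2⌋; _⊔_; z≤n; s≤s)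
import Data.Nat as ℕ
open import Data.Nat.Properties
  using (≤-refl; ≤-reflexive; ≤-trans; n≤1+n; <⇒≱; +-suc; +-comm; +-identityʳ; m≤m+n;
         +-mono-≤; *-comm; ⊔-lub; m≥n⇒m⊔n≡m; n≡⌊n+n/2⌋)
open import Data.Nat.Divisibility using (_∣_; divides)
open import Data.Fin using (toℕ)
open import Data.List using (List; []; _∷_; _++_; length; concat; map; filter; foldr; take)
open import Data.List.Properties using (filter-accept; filter-reject; ++-assoc; length-++; ++-identityʳ)
open import Data.List.Relation.Unary.All as All using (All; []; _∷_)
open import Data.List.Relation.Unary.Any as Any using (Any; here; there)
open import Data.List.Relation.Unary.Unique.Propositional using (Unique)
open import Data.List.Relation.Unary.AllPairs using ([]; _∷_)
open import Data.List.Relation.Binary.Sublist.Propositional using (_⊆_; []; _∷_; _∷ʳ_; minimum; ⊆-refl; ⊆-trans)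
open import Data.List.Relation.Binary.Sublist.Propositional.Properties
  using (++⁺; ++⁺ˡ; Any-resp-⊆; All-resp-⊆; all⊆concat)
open import Data.List.Membership.Propositional using (_∈_; _∉_; find; lose)
open import Data.List.Membership.Propositional.Properties
  using (∈-++⁺ˡ; ∈-++⁺ʳ; ∈-++⁻; ∈-map⁺; ∈-map⁻; ∈-concat⁺; ∈-concat⁻; ∈-concatMap⁺; ∈-concatMap⁻)
open import Data.List.Membership.DecPropositional ℕ._≟_ using (_∈?_)
open import Data.Product using (_×_; _,_; Σ; ∃; ∃₂; proj₁; proj₂)
open import Data.Sum using (inj₁; inj₂)
open import Data.Empty using (⊥-elim)
open import Relation.Nullary using (yes; no)
open import Relation.Binary.PropositionalEquality
open import Data.Nat.Tactic.RingSolver using (solve-∀)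

Unique-resp-⊇ : ∀ {A : Set} {xs ys : List A} → xs ⊆ ys → Unique ys → Unique xs
Unique-resp-⊇ []       []          = []
Unique-resp-⊇ (y ∷ʳ τ) (_ ∷ u)     = Unique-resp-⊇ τ u
Unique-resp-⊇ (refl ∷ τ) (x∉ ∷ u) = All-resp-⊆ τ x∉ ∷ Unique-resp-⊇ τ u

Unique-++-disjoint : ∀ {A : Set} (xs : List A) {ys x} → Unique (xs ++ ys) → x ∈ xs → x ∉ ys
Unique-++-disjoint (_ ∷ xs) (x∉ ∷ _) (here refl) x∈ys = All.lookup x∉ (∈-++⁺ʳ xs x∈ys) refl
Unique-++-disjoint (_ ∷ xs) (_ ∷ u)  (there x∈xs) x∈ys = Unique-++-disjoint xs u x∈xs x∈ys

∈⇒⊆concat : ∀ {A : Set} {S : List A} {𝒮} → S ∈ 𝒮 → S ⊆ concat 𝒮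
∈⇒⊆concat {𝒮 = 𝒮} = All.lookup (all⊆concat 𝒮)

nonempty-member : ∀ {A : Set} {xs : List A} → 1 ≤ length xs → ∃ (_∈ xs)
nonempty-member {xs = x ∷ _} _ = x , here refl

concat-singleton-length : ∀ {A : Set} {k} {𝒮 : List (List A)} →
  length 𝒮 ≡ 1 → All (λ S → length S ≡ k) 𝒮 → length (concat 𝒮) ≡ k
concat-singleton-length {𝒮 = S ∷ []} _ (len ∷ []) = trans (cong length (++-identityʳ S)) len

filter-∈-sublist : ∀ {K L ys : List ℕ} → L ⊆ ys → Unique ys →
  (∀ {z} → z ∈ ys → z ∈ K → z ∈ L) → All (_∈ K) L → filter (_∈? K) ys ≡ L
filter-∈-sublist [] [] _ [] = refl
filter-∈-sublist {K} (y ∷ʳ τ) (y∉ys ∷ u) complete sound =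
  trans (filter-reject (_∈? K) y∉K) (filter-∈-sublist τ u (λ z∈ → complete (there z∈)) sound)
  where
  y∉K : y ∉ K
  y∉K y∈K = All.lookup y∉ys (Any-resp-⊆ τ (complete (here refl) y∈K)) refl
filter-∈-sublist {K} {x ∷ L} (refl ∷ τ) (x∉ys ∷ u) complete (x∈K ∷ sound) =
  trans (filter-accept (_∈? K) x∈K) (cong (x ∷_) (filter-∈-sublist τ u complete′ sound))
  where
  complete′ : ∀ {z} → z ∈ _ → z ∈ K → z ∈ L
  complete′ z∈ys z∈K with complete (there z∈ys) z∈K
  ... | here refl = ⊥-elim (All.lookup x∉ys z∈ys refl)
  ... | there z∈L = z∈L

foldr-⊔-≤ : ∀ {A : Set} (f : A → ℕ) {C} xs → (∀ {x} → x ∈ xs → f x ≤ C) →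
  foldr (λ x m → f x ⊔ m) 0 xs ≤ C
foldr-⊔-≤ f []       _     = z≤n
foldr-⊔-≤ f (x ∷ xs) bound = ⊔-lub (bound (here refl)) (foldr-⊔-≤ f xs (λ x∈ → bound (there x∈)))

foldr-⊔-constant : ∀ {A : Set} (f : A → ℕ) {C} xs → (∀ {x} → x ∈ xs → f x ≡ C) →
  ∃ (_∈ xs) → foldr (λ x m → f x ⊔ m) 0 xs ≡ C
foldr-⊔-constant f (x ∷ xs) const _ =
  trans (cong (_⊔ _) (const (here refl)))
        (m≥n⇒m⊔n≡m (foldr-⊔-≤ f xs (λ x∈ → ≤-reflexive (const (there x∈)))))

∈-imapFrom⁻ : ∀ {A B : Set} n (f : ℕ → A → List B) xs {y} → y ∈ concat (imapFrom n f xs) →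
  ∃₂ λ c x → x ∈ xs × y ∈ f c x × (∀ {z} → z ∈ f c x → z ∈ concat (imapFrom n f xs))
∈-imapFrom⁻ n f (x ∷ xs) y∈ with ∈-++⁻ (f n x) y∈
... | inj₁ y∈fx = n , x , here refl , y∈fx , ∈-++⁺ˡ
... | inj₂ y∈rest =
  let c , x′ , x′∈ , y∈fx′ , block⊆ = ∈-imapFrom⁻ (suc n) f xs y∈rest
  in c , x′ , there x′∈ , y∈fx′ , λ z∈ → ∈-++⁺ʳ (f n x) (block⊆ z∈)

∈-imapFrom⁺ : ∀ {A B : Set} n (f : ℕ → A → List B) xs {x} → x ∈ xs →
  ∃ λ c → ∀ {y} → y ∈ f c x → y ∈ concat (imapFrom n f xs)
∈-imapFrom⁺ n f (x ∷ xs) (here refl) = n , ∈-++⁺ˡ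
∈-imapFrom⁺ n f (x ∷ xs) (there x∈) =
  let c , block⊆ = ∈-imapFrom⁺ (suc n) f xs x∈ in c , λ y∈ → ∈-++⁺ʳ (f n x) (block⊆ y∈)

even-halves : ∀ {C} → 2 ∣ C → ⌊ C /2⌋ + ⌊ C /2⌋ ≡ C
even-halves {C} (divides q C≡q*2) = begin
  ⌊ C /2⌋ + ⌊ C /2⌋          ≡⟨ cong (λ n → ⌊ n /2⌋ + ⌊ n /2⌋) C≡q+q ⟩
  ⌊ q + q /2⌋ + ⌊ q + q /2⌋  ≡⟨ cong₂ _+_ (sym (n≡⌊n+n/2⌋ q)) (sym (n≡⌊n+n/2⌋ q)) ⟩
  q + q                      ≡⟨ sym C≡q+q ⟩
  C                          ∎
  where
  open ≡-Reasoning
  C≡q+q : C ≡ q + q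
  C≡q+q = trans C≡q*2 (trans (*-comm q 2) (cong (q +_) (+-identityʳ q)))

positive-half : ∀ {C h} → 2 ≤ C → h + h ≡ C → 1 ≤ h
positive-half {h = zero}  () refl
positive-half {h = suc h} _   _    = s≤s z≤n

double-suc+ : ∀ n k → 2 * suc n + k ≡ 2 * n + suc (suc k)
double-suc+ = solve-∀
choose-sound : ∀ k xs {a} → a ∈ choose k xs → a ⊆ xs × length a ≡ k
choose-sound zero    xs       (here refl) = minimum xs , refl
choose-sound (suc k) (x ∷ xs) a∈ with ∈-++⁻ (map (x ∷_) (choose k xs)) a∈
... | inj₂ a∈skip = let sub , len = choose-sound (suc k) xs a∈skip in x ∷ʳ sub , len
... | inj₁ a∈keep with ∈-map⁻ (x ∷_) a∈keep
...   | b , b∈ , refl = let sub , len = choose-sound k xs b∈ in refl ∷ sub , cong suc len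

take∈choose : ∀ k xs → k ≤ length xs → take k xs ∈ choose k xs
take∈choose zero    xs       _         = here refl
take∈choose (suc k) (x ∷ xs) (s≤s k≤) = ∈-++⁺ˡ (∈-map⁺ (x ∷_) (take∈choose k xs k≤))

-- 𝒮′ ∈ I(𝒮), spelled out: each consecutive pair (a, b) of 𝒮 is replaced by
-- a′ ++ b′ for h-subsets a′ of a and b′ of b (a trailing single part is dropped).
data Interleaving (h : ℕ) : List LabelSet → List LabelSet → Set where
  done  : Interleaving h [] []
  odd   : ∀ a → Interleaving h (a ∷ []) []
  merge : ∀ {a b rest a′ b′ 𝒮′} → a′ ∈ choose h a → b′ ∈ choose h b →
          Interleaving h rest 𝒮′ → Interleaving h (a ∷ b ∷ rest) ((a′ ++ b′) ∷ 𝒮′)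

interleaving⁻ : ∀ h 𝒮 {𝒮′} → 𝒮′ ∈ interleave h 𝒮 → Interleaving h 𝒮 𝒮′
interleaving⁻ h []       (here refl) = done
interleaving⁻ h (a ∷ []) (here refl) = odd a
interleaving⁻ h (a ∷ b ∷ rest) 𝒮′∈
  with find (∈-concatMap⁻ (λ x → map (x ∷_) (interleave h rest)) {interleave₂ h a b} 𝒮′∈)
... | x , x∈ , 𝒮′∈map with ∈-map⁻ (x ∷_) 𝒮′∈map
...   | 𝒮″ , 𝒮″∈ , refl
  with find (∈-concatMap⁻ (λ a′ → map (λ b′ → a′ ++ b′) (choose h b)) {choose h a} x∈)
...     | a′ , a′∈ , x∈map with ∈-map⁻ (λ b′ → a′ ++ b′) x∈map
...       | b′ , b′∈ , refl = merge a′∈ b′∈ (interleaving⁻ h rest 𝒮″∈)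

interleaving-exists : ∀ h 𝒮 → All (λ S → length S ≡ h + h) 𝒮 → ∃ (_∈ interleave h 𝒮)
interleaving-exists h []       _ = [] , here refl
interleaving-exists h (a ∷ []) _ = [] , here refl
interleaving-exists h (a ∷ b ∷ rest) (|a| ∷ |b| ∷ sizes) =
  let 𝒮″ , 𝒮″∈ = interleaving-exists h rest sizes
  in (take h a ++ take h b) ∷ 𝒮″ ,
     ∈-concatMap⁺ (λ x → map (x ∷_) (interleave h rest)) (lose merged∈ (∈-map⁺ (_ ∷_) 𝒮″∈))
  where
  half≤ : ∀ {S : LabelSet} → length S ≡ h + h → h ≤ length S
  half≤ |S| = subst (h ≤_) (sym |S|) (m≤m+n h h)
  merged∈ : take h a ++ take h b ∈ interleave₂ h a b
  merged∈ = ∈-concatMap⁺ (λ a′ → map (λ b′ → a′ ++ b′) (choose h b))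
              (lose (take∈choose h a (half≤ {a} |a|))
                    (∈-map⁺ (λ b′ → take h a ++ b′) (take∈choose h b (half≤ {b} |b|))))

interleaving-⊆ : ∀ {h 𝒮 𝒮′} → Interleaving h 𝒮 𝒮′ → concat 𝒮′ ⊆ concat 𝒮
interleaving-⊆ done    = []
interleaving-⊆ (odd a) = minimum _
interleaving-⊆ {h} (merge {a} {b} {rest} a′∈ b′∈ v) =
  subst (_ ⊆_) (++-assoc a b (concat rest))
    (++⁺ (++⁺ (proj₁ (choose-sound h a a′∈)) (proj₁ (choose-sound h b b′∈))) (interleaving-⊆ v))

interleaving-length : ∀ {h 𝒮 𝒮′} → Interleaving h 𝒮 𝒮′ → length 𝒮′ ≡ ⌊ length 𝒮 /2⌋
interleaving-length done            = refl
interleaving-length (odd _)         = refl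
interleaving-length (merge _ _ v)   = cong suc (interleaving-length v)

interleaving-sizes : ∀ {h 𝒮 𝒮′} → Interleaving h 𝒮 𝒮′ → All (λ S → length S ≡ h + h) 𝒮′
interleaving-sizes done  = []
interleaving-sizes (odd _) = []
interleaving-sizes {h} (merge {a} {b} {a′ = a′} a′∈ b′∈ v) =
  trans (length-++ a′) (cong₂ _+_ (proj₂ (choose-sound h a a′∈)) (proj₂ (choose-sound h b b′∈)))
  ∷ interleaving-sizes v

-- The standing assumptions on 𝒮 for depth D = d + 1 and part size C = 2h.
record WellFormed (h d : ℕ) (𝒮 : List LabelSet) : Set where
  field
    parts    : length 𝒮 ≡ 2 ^ d
    partSize : All (λ S → length S ≡ h + h) 𝒮
    distinct : Unique (concat 𝒮)
open WellFormed

interleaving-wellFormed : ∀ {h d 𝒮 𝒮′} → WellFormed h (suc d) 𝒮 → Interleaving h 𝒮 𝒮′ →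
  WellFormed h d 𝒮′
interleaving-wellFormed {d = d} wf v = record
  { parts    = trans (interleaving-length v)
                     (trans (cong ⌊_/2⌋ (trans (parts wf) 2^[1+d]))
                            (sym (n≡⌊n+n/2⌋ (2 ^ d))))
  ; partSize = interleaving-sizes v
  ; distinct = Unique-resp-⊇ (interleaving-⊆ v) (distinct wf)
  }
  where
  2^[1+d] : 2 ^ suc d ≡ 2 ^ d + 2 ^ d
  2^[1+d] = cong (2 ^ d +_) (+-identityʳ (2 ^ d))

indexOf-position : ∀ {ℓ} 𝒮 → Unique (concat 𝒮) → (p : Any (ℓ ∈_) 𝒮) →
  indexOf ℓ 𝒮 ≡ toℕ (Any.index p)
indexOf-position {ℓ} (S ∷ 𝒮) u (here ℓ∈S) with ℓ ∈? S
... | yes _   = refl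
... | no ℓ∉S = ⊥-elim (ℓ∉S ℓ∈S)
indexOf-position {ℓ} (S ∷ 𝒮) u (there p) with ℓ ∈? S
... | yes ℓ∈S = ⊥-elim (Unique-++-disjoint S u ℓ∈S (∈-concat⁺ p))
... | no _    = cong suc (indexOf-position 𝒮 (Unique-resp-⊇ (++⁺ˡ S ⊆-refl) u) p)

-- The edges e_{2i+1}, e_{2i+2} of step (1) for the i-th pair of 𝒮 (from 0) ...
pairEdges : ℕ → LabelSet × LabelSet → List Edge
pairEdges i p = edge (rt (2 * i)) (vt i) (proj₁ p) ∷ edge (rt (suc (2 * i))) (vt i) (proj₂ p) ∷ []

topEdges : ℕ → List LabelSet → List Edge
topEdges n 𝒮 = concat (imapFrom n pairEdges (pairs 𝒮))

copyEdges : ℕ → ℕ → ℕ → List LabelSet → List Edge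
copyEdges h d c 𝒮′ = map (renameE c) (edgesG h d 𝒮′)

data EdgeOrigin (h d : ℕ) (𝒮 : List LabelSet) : Edge → Set where
  top  : ∀ {e} → e ∈ topEdges 0 𝒮 → EdgeOrigin h d 𝒮 e
  copy : ∀ {c 𝒮′ e} → 𝒮′ ∈ interleave h 𝒮 →
         (∀ {e′} → e′ ∈ edgesG h d 𝒮′ → renameE c e′ ∈ edgesG h (suc d) 𝒮) →
         e ∈ edgesG h d 𝒮′ → EdgeOrigin h d 𝒮 (renameE c e)

edge-origin : ∀ {h d 𝒮 e} → e ∈ edgesG h (suc d) 𝒮 → EdgeOrigin h d 𝒮 e
edge-origin {h} {d} {𝒮} e∈ with ∈-++⁻ (topEdges 0 𝒮) e∈
... | inj₁ e∈top = top e∈top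
... | inj₂ e∈copies with ∈-imapFrom⁻ 0 (copyEdges h d) (interleave h 𝒮) e∈copies
...   | c , 𝒮′ , 𝒮′∈ , e∈copy , copy⊆ with ∈-map⁻ (renameE c) e∈copy
...     | e′ , e′∈ , refl =
  copy 𝒮′∈ (λ e″∈ → ∈-++⁺ʳ (topEdges 0 𝒮) (copy⊆ (∈-map⁺ (renameE c) e″∈))) e′∈

copy-embedding : ∀ {h d 𝒮 𝒮′} → 𝒮′ ∈ interleave h 𝒮 →
  ∃ λ c → ∀ {e′} → e′ ∈ edgesG h d 𝒮′ → renameE c e′ ∈ edgesG h (suc d) 𝒮
copy-embedding {h} {d} {𝒮} 𝒮′∈ =
  let c , copy⊆ = ∈-imapFrom⁺ 0 (copyEdges h d) (interleave h 𝒮) 𝒮′∈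
  in c , λ e′∈ → ∈-++⁺ʳ (topEdges 0 𝒮) (copy⊆ (∈-map⁺ (renameE c) e′∈))

top-labels : ∀ n 𝒮 {e} → e ∈ topEdges n 𝒮 → labels e ∈ 𝒮
top-labels n (a ∷ b ∷ rest) (here refl)         = here refl
top-labels n (a ∷ b ∷ rest) (there (here refl)) = there (here refl)
top-labels n (a ∷ b ∷ rest) (there (there e∈))  = there (there (top-labels (suc n) rest e∈))

top-source : ∀ n 𝒮 {e ℓ} → e ∈ topEdges n 𝒮 → ℓ ∈ labels e →
  Σ (Any (ℓ ∈_) 𝒮) λ p → end₁ e ≡ rt (2 * n + toℕ (Any.index p))
top-source n (a ∷ b ∷ rest) (here refl)         ℓ∈ = here ℓ∈ , cong rt (sym (+-identityʳ (2 * n)))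
top-source n (a ∷ b ∷ rest) (there (here refl)) ℓ∈ = there (here ℓ∈) , cong rt (sym (+-comm (2 * n) 1))
top-source n (a ∷ b ∷ rest) (there (there e∈))  ℓ∈ =
  let p , src = top-source (suc n) rest e∈ ℓ∈
  in there (there p) , trans src (cong rt (double-suc+ n (toℕ (Any.index p))))

top-from-root : ∀ {𝒮 e ℓ} → Unique (concat 𝒮) → e ∈ topEdges 0 𝒮 → ℓ ∈ labels e →
  end₁ e ≡ rt (indexOf ℓ 𝒮)
top-from-root {𝒮} u e∈ ℓ∈ =
  let p , src = top-source 0 𝒮 e∈ ℓ∈ in trans src (cong rt (sym (indexOf-position 𝒮 u p)))

-- If ℓ lies in the part of 𝒮′ ∈ I(𝒮) at position k, a top edge carrying ℓ
-- ends at v_k (the pair edges e_{2k+1}, e_{2k+2} both end there).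
top-entry : ∀ {h 𝒮 𝒮′ ℓ} n → Interleaving h 𝒮 𝒮′ → (p : Any (ℓ ∈_) 𝒮′) →
  ∃ λ e → e ∈ topEdges n 𝒮 × ℓ ∈ labels e × end₂ e ≡ vt (n + toℕ (Any.index p))
top-entry {h} n (merge {a} {b} {a′ = a′} a′∈ b′∈ _) (here ℓ∈) with ∈-++⁻ a′ ℓ∈
... | inj₁ ℓ∈a′ = _ , here refl , Any-resp-⊆ (proj₁ (choose-sound h a a′∈)) ℓ∈a′ ,
                  cong vt (sym (+-identityʳ n))
... | inj₂ ℓ∈b′ = _ , there (here refl) , Any-resp-⊆ (proj₁ (choose-sound h b b′∈)) ℓ∈b′ ,
                  cong vt (sym (+-identityʳ n))
top-entry n (merge _ _ v) (there p) =
  let e , e∈ , ℓ∈ , tgt = top-entry (suc n) v p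
  in e , there (there e∈) , ℓ∈ , trans tgt (cong vt (sym (+-suc n (toℕ (Any.index p)))))

level : Vtx → ℕ
level (rt _)      = 0
level (vt _)      = 1
level (inner _ w) = suc (level w)

-- Step (3) renaming raises levels by one (roots of a copy become v_k).
level-rename : ∀ c w → level (renameV c w) ≡ suc (level w)
level-rename c (rt _)      = refl
level-rename c (vt _)      = refl
level-rename c (inner _ _) = refl

root-level : ∀ d 𝒮 ℓ → level (rootG d 𝒮 ℓ) ≡ 0
root-level zero    _ _ = refl
root-level (suc d) _ _ = refl

top-levels : ∀ n 𝒮 {e} → e ∈ topEdges n 𝒮 → level (end₁ e) ≡ 0 × level (end₂ e) ≡ 1
top-levels n (a ∷ b ∷ rest) (here refl)         = refl , refl
top-levels n (a ∷ b ∷ rest) (there (here refl)) = refl , refl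
top-levels n (a ∷ b ∷ rest) (there (there e∈))  = top-levels (suc n) rest e∈

edge-levels : ∀ {h} d 𝒮 {e} → e ∈ edgesG h d 𝒮 →
  level (end₂ e) ≡ suc (level (end₁ e)) × level (end₂ e) ≤ suc d
edge-levels zero 𝒮 (here refl) = refl , ≤-refl
edge-levels {h} (suc d) 𝒮 e∈ with edge-origin {h} {d} {𝒮} e∈
... | top e∈top =
  let src , tgt = top-levels 0 𝒮 e∈top
  in trans tgt (cong suc (sym src)) , subst (_≤ suc (suc d)) (sym tgt) (s≤s z≤n)
... | copy {c} {e = e′} _ _ e′∈ =
  let step , bound = edge-levels d _ e′∈
  in trans (level-rename c (end₂ e′)) (trans (cong suc step) (cong suc (sym (level-rename c (end₁ e′))))) ,
     subst (_≤ suc (suc d)) (sym (level-rename c (end₂ e′))) (s≤s bound)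

edge-labels : ∀ {h d 𝒮 e} → WellFormed h d 𝒮 → e ∈ edgesG h d 𝒮 →
  labels e ⊆ concat 𝒮 × length (labels e) ≡ h + h
edge-labels {d = zero} wf (here refl) = ⊆-refl , concat-singleton-length (parts wf) (partSize wf)
edge-labels {h} {suc d} {𝒮} wf e∈ with edge-origin {h} {d} {𝒮} e∈
... | top e∈top =
  ∈⇒⊆concat (top-labels 0 𝒮 e∈top) , All.lookup (partSize wf) (top-labels 0 𝒮 e∈top)
... | copy {𝒮′ = 𝒮′} 𝒮′∈ _ e′∈ =
  let v = interleaving⁻ _ 𝒮 𝒮′∈
      sub , len = edge-labels (interleaving-wellFormed wf v) e′∈
  in ⊆-trans sub (interleaving-⊆ v) , len

-- As the labels are distinct, every edge lies in exactly 2h trees.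
edge-load : ∀ {h d 𝒮 e} → WellFormed h d 𝒮 → e ∈ edgesG h d 𝒮 → load (M h d 𝒮) e ≡ h + h
edge-load wf e∈ =
  let sub , len = edge-labels wf e∈
  in trans (cong length (filter-∈-sublist sub (distinct wf) (λ _ ℓ∈ → ℓ∈) (All.tabulate (λ ℓ∈ → ℓ∈))))
           len

walk-rename : ∀ {I J ℓ x y n} c → (∀ {e} → e ∈ edges I → renameE c e ∈ edges J) →
  Walk I ℓ x y n → Walk J ℓ (renameV c x) (renameV c y) n
walk-rename c embed stop                = stop
walk-rename c embed (fwd e (e∈ , ℓ∈) w) = fwd (renameE c e) (embed e∈ , ℓ∈) (walk-rename c embed w)
walk-rename c embed (bwd e (e∈ , ℓ∈) w) = bwd (renameE c e) (embed e∈ , ℓ∈) (walk-rename c embed w)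

walk-++ : ∀ {I ℓ x y z m n} → Walk I ℓ x y m → Walk I ℓ y z n → Walk I ℓ x z (m + n)
walk-++ stop        w = w
walk-++ (fwd e t v) w = fwd e t (walk-++ v w)
walk-++ (bwd e t v) w = bwd e t (walk-++ v w)

walk-snoc : ∀ {I ℓ x n} e → TreeEdge I ℓ e → Walk I ℓ x (end₁ e) n → Walk I ℓ x (end₂ e) (suc n)
walk-snoc {n = n} e t w = subst (Walk _ _ _ _) (+-comm n 1) (walk-++ w (fwd e t stop))

walk-potential : ∀ {I ℓ x y n} (f : Vtx → ℕ) →
  (∀ {e} → e ∈ edges I → f (end₂ e) ≡ suc (f (end₁ e))) → Walk I ℓ x y n → f y ≤ n + f x
walk-potential f rises stop = ≤-refl
walk-potential {n = suc n} f rises (fwd e (e∈ , _) w) =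
  ≤-trans (walk-potential f rises w) (≤-reflexive (trans (cong (n +_) (rises e∈)) (+-suc n _)))
walk-potential {n = suc n} f rises (bwd e (e∈ , _) w) =
  ≤-trans (walk-potential f rises w)
          (+-mono-≤ (n≤1+n n) (subst (f (end₁ e) ≤_) (sym (rises e∈)) (n≤1+n _)))

copy-root : ∀ {h d 𝒮′ ℓ} c → WellFormed h d 𝒮′ → (p : Any (ℓ ∈_) 𝒮′) →
  renameV c (rootG d 𝒮′ ℓ) ≡ vt (toℕ (Any.index p))
copy-root {d = zero} {[]}        c _  ()
copy-root {d = zero} {_ ∷ []}    c _  (here _)   = refl
copy-root {d = zero} {_ ∷ []}    c _  (there ())
copy-root {d = zero} {_ ∷ _ ∷ _} c wf _ with parts wf
... | ()
copy-root {d = suc d} {𝒮′} c wf p = cong vt (indexOf-position 𝒮′ (distinct wf) p)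

copy-entry : ∀ {h d 𝒮 𝒮′ ℓ} c → WellFormed h (suc d) 𝒮 → 𝒮′ ∈ interleave h 𝒮 → ℓ ∈ concat 𝒮′ →
  Walk (M h (suc d) 𝒮) ℓ (rootG (suc d) 𝒮 ℓ) (renameV c (rootG d 𝒮′ ℓ)) 1
copy-entry {h} {d} {𝒮} {𝒮′} {ℓ} c wf 𝒮′∈ ℓ∈ = through (top-entry 0 v p)
  where
  v : Interleaving h 𝒮 𝒮′
  v = interleaving⁻ h 𝒮 𝒮′∈
  p : Any (ℓ ∈_) 𝒮′
  p = ∈-concat⁻ 𝒮′ ℓ∈
  through : (∃ λ e → e ∈ topEdges 0 𝒮 × ℓ ∈ labels e × end₂ e ≡ vt (toℕ (Any.index p))) →
            Walk (M h (suc d) 𝒮) ℓ (rootG (suc d) 𝒮 ℓ) (renameV c (rootG d 𝒮′ ℓ)) 1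
  through (e , e∈ , ℓ∈e , tgt) =
    subst₂ (λ x y → Walk (M h (suc d) 𝒮) ℓ x y 1)
      (top-from-root {𝒮} (distinct wf) e∈ ℓ∈e)
      (trans tgt (sym (copy-root c (interleaving-wellFormed wf v) p)))
      (fwd e (∈-++⁺ˡ e∈ , ℓ∈e) stop)

walk-from-root : ∀ {h d 𝒮 ℓ e} → WellFormed h d 𝒮 → e ∈ edgesG h d 𝒮 → ℓ ∈ labels e →
  Walk (M h d 𝒮) ℓ (rootG d 𝒮 ℓ) (end₁ e) (level (end₁ e))
walk-from-root {d = zero} _ (here refl) _ = stop
walk-from-root {h} {suc d} {𝒮} {ℓ} wf e∈ ℓ∈ with edge-origin {h} {d} {𝒮} e∈
... | top e∈top =
  subst (λ x → Walk (M h (suc d) 𝒮) ℓ (rt (indexOf ℓ 𝒮)) x (level x))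
        (sym (top-from-root {𝒮} (distinct wf) e∈top ℓ∈)) stop
... | copy {c} {𝒮′} {e′} 𝒮′∈ embed e′∈ =
  subst (Walk (M h (suc d) 𝒮) ℓ (rt (indexOf ℓ 𝒮)) (renameV c (end₁ e′)))
        (sym (level-rename c (end₁ e′)))
        (walk-++ (copy-entry c wf 𝒮′∈ ℓ∈𝒮′) (walk-rename c embed (walk-from-root wf′ e′∈ ℓ∈)))
  where
  wf′ : WellFormed h d 𝒮′
  wf′ = interleaving-wellFormed wf (interleaving⁻ h 𝒮 𝒮′∈)
  ℓ∈𝒮′ : ℓ ∈ concat 𝒮′
  ℓ∈𝒮′ = Any-resp-⊆ (proj₁ (edge-labels wf′ e′∈)) ℓ∈

tree-vertex-walk : ∀ {h d 𝒮 ℓ x} → WellFormed h d 𝒮 → TreeVtx (M h d 𝒮) ℓ x →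
  Walk (M h d 𝒮) ℓ (rootG d 𝒮 ℓ) x (level x)
tree-vertex-walk {d = d} {𝒮} {ℓ} wf (inj₁ refl) = subst (Walk _ ℓ _ _) (sym (root-level d 𝒮 ℓ)) stop
tree-vertex-walk wf (inj₂ (e , (e∈ , ℓ∈) , inj₁ refl)) = walk-from-root wf e∈ ℓ∈
tree-vertex-walk {d = d} {𝒮} wf (inj₂ (e , (e∈ , ℓ∈) , inj₂ refl)) =
  subst (Walk _ _ _ _) (sym (proj₁ (edge-levels d 𝒮 e∈)))
        (walk-snoc e (e∈ , ℓ∈) (walk-from-root wf e∈ ℓ∈))

tree-vertex-level : ∀ {h d 𝒮 ℓ x} → TreeVtx (M h d 𝒮) ℓ x → level x ≤ suc d
tree-vertex-level {d = d} {𝒮} {ℓ} (inj₁ refl) = subst (_≤ suc d) (sym (root-level d 𝒮 ℓ)) z≤n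
tree-vertex-level {d = d} {𝒮} (inj₂ (e , (e∈ , _) , inj₁ refl)) =
  let step , bound = edge-levels d 𝒮 e∈ in ≤-trans (n≤1+n _) (subst (_≤ suc d) step bound)
tree-vertex-level {d = d} {𝒮} (inj₂ (e , (e∈ , _) , inj₂ refl)) = proj₂ (edge-levels d 𝒮 e∈)

walk-length-≥-level : ∀ {h d 𝒮 ℓ x m} → Walk (M h d 𝒮) ℓ (rootG d 𝒮 ℓ) x m → level x ≤ m
walk-length-≥-level {d = d} {𝒮} {ℓ} {x} {m} w =
  subst (level x ≤_) (trans (cong (m +_) (root-level d 𝒮 ℓ)) (+-identityʳ m))
        (walk-potential level (λ e∈ → proj₁ (edge-levels d 𝒮 e∈)) w)

distance-is-level : ∀ {h d 𝒮 ℓ x} → WellFormed h d 𝒮 → TreeVtx (M h d 𝒮) ℓ x →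
  DistFromRoot (M h d 𝒮) ℓ x (level x)
distance-is-level wf t = tree-vertex-walk wf t , λ m m<level w → <⇒≱ m<level (walk-length-≥-level w)

deepest-edge : ∀ {h d 𝒮} → 1 ≤ h → WellFormed h d 𝒮 →
  ∃₂ λ ℓ e → e ∈ edgesG h d 𝒮 × ℓ ∈ labels e × level (end₂ e) ≡ suc d
deepest-edge {h} {zero} {𝒮} 1≤h wf =
  let ℓ , ℓ∈ = nonempty-member (subst (1 ≤_) (sym (concat-singleton-length (parts wf) (partSize wf)))
                                         (≤-trans 1≤h (m≤m+n h h)))
  in ℓ , _ , here refl , ℓ∈ , refl
deepest-edge {h} {suc d} {𝒮} 1≤h wf =
  let 𝒮′ , 𝒮′∈ = interleaving-exists h 𝒮 (partSize wf)
      ℓ , e′ , e′∈ , ℓ∈ , deep = deepest-edge 1≤h (interleaving-wellFormed wf (interleaving⁻ h 𝒮 𝒮′∈))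
      c , embed = copy-embedding {h} {d} {𝒮} 𝒮′∈
  in ℓ , renameE c e′ , embed e′∈ , ℓ∈ , trans (level-rename c (end₂ e′)) (cong suc deep)

congestion-M : ∀ {h d 𝒮} → 1 ≤ h → WellFormed h d 𝒮 → congestion (M h d 𝒮) ≡ h + h
congestion-M {h} {d} {𝒮} 1≤h wf =
  let _ , e , e∈ , _ = deepest-edge 1≤h wf
  in foldr-⊔-constant (load (M h d 𝒮)) (edgesG h d 𝒮) (edge-load wf) (e , e∈)

dilation-M : ∀ {h d 𝒮} → 1 ≤ h → WellFormed h d 𝒮 → HasDilation (M h d 𝒮) (suc d)
dilation-M {h} {d} {𝒮} 1≤h wf = bounded , attained
  where
  I : Multicast
  I = M h d 𝒮
  bounded : ∀ ℓ → ℓ ∈ allLabels I → ∀ x → TreeVtx I ℓ x → ∃ λ n → n ≤ suc d × Walk I ℓ (root I ℓ) x n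
  bounded ℓ _ x t = level x , tree-vertex-level t , tree-vertex-walk wf t
  attained : ∃ λ ℓ → ℓ ∈ allLabels I × ∃ λ x → TreeVtx I ℓ x × DistFromRoot I ℓ x (suc d)
  attained =
    let ℓ , e , e∈ , ℓ∈ , deep = deepest-edge 1≤h wf
        t = inj₂ (e , (e∈ , ℓ∈) , inj₂ refl)
    in ℓ , Any-resp-⊆ (proj₁ (edge-labels wf e∈)) ℓ∈ , end₂ e , t ,
       subst (DistFromRoot I ℓ (end₂ e)) deep (distance-is-level wf t)

lemma2 : (C D : ℕ) → 2 ≤ C → 2 ∣ C → 1 ≤ D →
    (𝒮 : List LabelSet) →
    length 𝒮 ≡ 2 ^ (D ∸ 1) →
    All (λ S → length S ≡ C) 𝒮 →
    Unique (concat 𝒮) →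
    congestion (M ⌊ C /2⌋ (D ∸ 1) 𝒮) ≡ C × HasDilation (M ⌊ C /2⌋ (D ∸ 1) 𝒮) D
lemma2 C (suc d) 2≤C 2∣C _ 𝒮 |𝒮| sizes unique = trans (congestion-M 1≤h wf) h+h≡C , dilation-M 1≤h wf
  where
  h : ℕ
  h = ⌊ C /2⌋
  h+h≡C : h + h ≡ C
  h+h≡C = even-halves 2∣C
  1≤h : 1 ≤ h
  1≤h = positive-half 2≤C h+h≡C
  wf : WellFormed h d 𝒮
  wf = record { parts    = |𝒮|
              ; partSize = All.map (λ |S| → trans |S| (sym h+h≡C)) sizes
              ; distinct = unique }
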